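{- Let $H=(V_H,E_H)$ be a graph with $E_H\neq\emptyset$, let $f:V_H\to\{0,1,2,\dots\}$, $C\subseteq V_H$, and $\epsilon>0$. Then in every extreme point (corner) solution $(y,z)$ of the linear program LP2$(H,f,C)$ there is at least one edge $e\in E_H$ with $y_e=0$ or $y_e\ge 1/2$.
   Context: LP2$(H,f,C)$ has variables $y_e$ ($e\in E_H$) and $z_v$ ($v\in V_H$): maximize $2\sum_{e\in E_H}y_e-(1+\epsilon)\sum_{v\in V_H}z_v$ subject to $\sum_{e\in\delta(v)}y_e\le f_v+z_v$ for all $v\in V_H\setminus C$; $\sum_{e\in\delta(v)}y_e\le f_v$ for all $v\in C$; $z_v\ge 0$ for all $v\in V_H$; $0\le y_e\le 1$ for all $e\in E_H$. Here $\delta(v)$ is the set of edges of $H$ incident on $v$. An extreme point solution is a vertex of the feasible polyhedron.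
   Formalization: The extreme point $(y,z)$, the feasible points against which its extremality is tested, and the parameter ε are all taken over the rationals. -}

module Defs where

open import Data.Nat as ℕ using (ℕ; zero; suc)
open import Data.Integer as ℤ using ()
open import Data.Fin using (Fin; zero; suc; _≟_)
open import Data.Fin.Subset using (Subset; _∈_; _∉_)
open import Data.Bool using (Bool; true; false; if_then_else_; _∨_)
open import Data.Rational using (ℚ; 0ℚ; 1ℚ; _/_; _+_; _*_; _-_; _≤_; _<_)
open import Data.Product using (Σ; ∃; _×_; _,_)
open import Data.Sum using (_⊎_)
open import Relation.Nullary using (¬_)
open import Relation.Nullary.Decidable using (⌊_⌋)
open import Relation.Binary.PropositionalEquality using (_≡_)

record Graph (n m : ℕ) : Set where
  field
    end₁ end₂ : Fin m → Fin n
    loopless  : ∀ e → ¬ (end₁ e ≡ end₂ e)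
    simple    : ∀ e e' → (end₁ e ≡ end₁ e' × end₂ e ≡ end₂ e')
                       ⊎ (end₁ e ≡ end₂ e' × end₂ e ≡ end₁ e') → e ≡ e'

Σℚ : (k : ℕ) → (Fin k → ℚ) → ℚ
Σℚ zero    g = 0ℚ
Σℚ (suc k) g = g zero + Σℚ k (λ i → g (suc i))

module _ {n m : ℕ} (H : Graph n m) where
  open Graph H

  incident : Fin n → Fin m → Bool
  incident v e = ⌊ end₁ e ≟ v ⌋ ∨ ⌊ end₂ e ≟ v ⌋

  δsum : (Fin m → ℚ) → Fin n → ℚ
  δsum y v = Σℚ m (λ e → if incident v e then y e else 0ℚ)

  -- Feasibility of (y , z) for LP2(H,f,C).
  -- (The objective, which involves ε, does not affect the feasible region.)
  Feasible : (f : Fin n → ℕ) (C : Subset n) → (Fin m → ℚ) → (Fin n → ℚ) → Set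
  Feasible f C y z =
      (∀ v → v ∉ C → δsum y v ≤ (ℤ.+ f v / 1) + z v)
    × (∀ v → v ∈ C → δsum y v ≤ (ℤ.+ f v / 1))
    × (∀ v → 0ℚ ≤ z v)
    × (∀ e → 0ℚ ≤ y e × y e ≤ 1ℚ)

  ExtremePoint : (f : Fin n → ℕ) (C : Subset n) → (Fin m → ℚ) → (Fin n → ℚ) → Set
  ExtremePoint f C y z =
      Feasible f C y z
    × (∀ (y₁ : Fin m → ℚ) (z₁ : Fin n → ℚ) (y₂ : Fin m → ℚ) (z₂ : Fin n → ℚ) (λ' : ℚ)
         → Feasible f C y₁ z₁ → Feasible f C y₂ z₂
         → 0ℚ < λ' → λ' < 1ℚ
         → (∀ e → y e ≡ λ' * y₁ e + (1ℚ - λ') * y₂ e)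
         → (∀ v → z v ≡ λ' * z₁ v + (1ℚ - λ') * z₂ v)
         → (∀ e → y₁ e ≡ y₂ e) × (∀ v → z₁ v ≡ z₂ v))

module Submission where

-- Suppose 0 < y_e < ½ for every edge.  Call the degree constraint at v
-- tight if it holds with equality and its right-hand side cannot move (v ∈ C, or
-- z_v = 0), and critical if moreover f_v ≥ 1.  Every critical v has δ y v = f_v ≥ 1,
-- while by the handshake inequality Σ_v δ y v ≤ Σ_e 2y_e < m; so there are fewer
-- critical vertices than edges.  Hence the homogeneous system "δ d v = 0 for every
-- critical v" has a nonzero solution d (Gaussian elimination).  Tight vertices with
-- f_v = 0 are isolated, so δ d v = 0 at every tight v.  Moving y by ±t·d, and z_v by
-- ±t·δ d v where z_v > 0, keeps all constraints valid for small t > 0; thus (y, z) is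
-- the midpoint of two distinct feasible points, contradicting extremality.

open import Defs
open import Algebra.Bundles using (CommutativeRing)
open import Level using (0ℓ)
open import Data.Nat using (ℕ; zero; suc; z≤n; s≤s) renaming (_≤_ to _≤ℕ_; _<_ to _<ℕ_)
import Data.Nat.Properties as ℕ
import Data.Nat.Coprimality as Coprimality
open import Data.Integer as ℤ using ()
open import Data.Fin as Fin using (Fin; zero; suc; fromℕ<)
import Data.Fin.Properties as Fin
open import Data.Fin.Subset using (Subset; _∈_; _∉_)
open import Data.Fin.Subset.Properties using (_∈?_)
open import Data.Bool using (true; false; if_then_else_; _∨_)
open import Data.Rational hiding (floor)
open import Data.Rational.Properties
open import Data.Rational.Solver using (module +-*-Solver)
open import Data.Vec.Functional as Vector using ()
open import Data.List as List using (List; []; _∷_; length)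
import Data.List.Properties as List
open import Data.List.Relation.Unary.All as All using (All; []; _∷_; all?)
open import Data.List.Relation.Unary.All.Properties using (¬All⇒Any¬; ─⁻; map⁻)
open import Data.List.Relation.Unary.Any as Any using (Any; _─_)
open import Data.List.Relation.Unary.Any.Properties using (lookup-result)
open import Data.Product using (∃; _×_; _,_; proj₁; proj₂)
open import Data.Sum using (_⊎_; inj₁; inj₂)
open import Relation.Nullary using (¬_; Dec; yes; no; contradiction)
open import Relation.Nullary.Decidable using (⌊_⌋; _×-dec_; _⊎-dec_)
open import Relation.Unary using (Pred; Decidable)
open import Relation.Binary.Definitions using (tri<; tri≈; tri>)
open import Relation.Binary.PropositionalEquality
open import Algebra.Properties.Semiring.Sum (CommutativeRing.semiring +-*-commutativeRing)
  using (sum; sum-cong-≗; ∑-distrib-+; ∑-comm; *-distribˡ-sum; sum-replicate-zero)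
open +-*-Solver using (solve; _:=_; _:+_; _:*_; :-_; _:-_; con)

Σℚ≡sum : ∀ k (g : Fin k → ℚ) → Σℚ k g ≡ sum g
Σℚ≡sum zero    g = refl
Σℚ≡sum (suc k) g = cong (g zero +_) (Σℚ≡sum k (λ i → g (suc i)))

Σℚ-cong : ∀ k {g h : Fin k → ℚ} → (∀ i → g i ≡ h i) → Σℚ k g ≡ Σℚ k h
Σℚ-cong zero    g≗h = refl
Σℚ-cong (suc k) g≗h = cong₂ _+_ (g≗h zero) (Σℚ-cong k (λ i → g≗h (suc i)))

Σℚ-zero : ∀ k → Σℚ k (λ _ → 0ℚ) ≡ 0ℚ
Σℚ-zero k = trans (Σℚ≡sum k _) (sum-replicate-zero k)

Σℚ-+ : ∀ k (g h : Fin k → ℚ) → Σℚ k (λ i → g i + h i) ≡ Σℚ k g + Σℚ k h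
Σℚ-+ k g h = begin
  Σℚ k (λ i → g i + h i)  ≡⟨ Σℚ≡sum k _ ⟩
  sum (λ i → g i + h i)   ≡⟨ ∑-distrib-+ g h ⟩
  sum g + sum h           ≡⟨ sym (cong₂ _+_ (Σℚ≡sum k g) (Σℚ≡sum k h)) ⟩
  Σℚ k g + Σℚ k h         ∎
  where open ≡-Reasoning

Σℚ-* : ∀ k c (g : Fin k → ℚ) → Σℚ k (λ i → c * g i) ≡ c * Σℚ k g
Σℚ-* k c g = begin
  Σℚ k (λ i → c * g i)  ≡⟨ Σℚ≡sum k _ ⟩
  sum (Vector.map (c *_) g)  ≡⟨ sym (*-distribˡ-sum c g) ⟩
  c * sum g             ≡⟨ cong (c *_) (sym (Σℚ≡sum k g)) ⟩
  c * Σℚ k g            ∎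
  where open ≡-Reasoning

Σℚ-linear : ∀ k (g h : Fin k → ℚ) c → Σℚ k (λ i → g i + c * h i) ≡ Σℚ k g + c * Σℚ k h
Σℚ-linear k g h c = trans (Σℚ-+ k g (λ i → c * h i)) (cong (Σℚ k g +_) (Σℚ-* k c h))

Σℚ-comm : ∀ k l (g : Fin k → Fin l → ℚ) → Σℚ k (λ i → Σℚ l (g i)) ≡ Σℚ l (λ j → Σℚ k (λ i → g i j))
Σℚ-comm k l g = begin
  Σℚ k (λ i → Σℚ l (g i))              ≡⟨ Σℚ≡sum k _ ⟩
  sum (λ i → Σℚ l (g i))               ≡⟨ sum-cong-≗ {k} (λ i → Σℚ≡sum l (g i)) ⟩
  sum (λ i → sum (g i))                ≡⟨ ∑-comm g ⟩
  sum (λ j → sum (λ i → g i j))        ≡⟨ sum-cong-≗ {l} (λ j → sym (Σℚ≡sum k (λ i → g i j))) ⟩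
  sum (λ j → Σℚ k (λ i → g i j))       ≡⟨ sym (Σℚ≡sum l _) ⟩
  Σℚ l (λ j → Σℚ k (λ i → g i j))      ∎
  where open ≡-Reasoning

Σℚ-mono : ∀ k {g h : Fin k → ℚ} → (∀ i → g i ≤ h i) → Σℚ k g ≤ Σℚ k h
Σℚ-mono zero    g≤h = ≤-refl
Σℚ-mono (suc k) g≤h = +-mono-≤ (g≤h zero) (Σℚ-mono k (λ i → g≤h (suc i)))

Σℚ-mono-< : ∀ k {g h : Fin k → ℚ} → (∀ i → g i ≤ h i) → ∀ j → g j < h j → Σℚ k g < Σℚ k h
Σℚ-mono-< (suc k) g≤h zero    g<h = +-mono-<-≤ g<h (Σℚ-mono k (λ i → g≤h (suc i)))
Σℚ-mono-< (suc k) g≤h (suc j) g<h = +-mono-≤-< (g≤h zero) (Σℚ-mono-< k (λ i → g≤h (suc i)) j g<h)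

Σℚ-nonneg : ∀ k {g : Fin k → ℚ} → (∀ i → 0ℚ ≤ g i) → 0ℚ ≤ Σℚ k g
Σℚ-nonneg k 0≤g = subst (_≤ Σℚ k _) (Σℚ-zero k) (Σℚ-mono k 0≤g)

infix 7 _·_
_·_ : ∀ {k} → (Fin k → ℚ) → (Fin k → ℚ) → ℚ
_·_ {k} a x = Σℚ k (λ i → a i * x i)

Solves : ∀ {k} → List (Fin k → ℚ) → (Fin k → ℚ) → Set
Solves rows x = All (λ a → a · x ≡ 0ℚ) rows

NonZeroVector : ∀ {k} → (Fin k → ℚ) → Set
NonZeroVector x = ∃ λ i → x i ≢ 0ℚ

e₀ : ∀ {k} → Fin (suc k) → ℚ
e₀ zero    = 1ℚ
e₀ (suc i) = 0ℚ

e₀-orthogonal : ∀ {k} (a : Fin (suc k) → ℚ) → a zero ≡ 0ℚ → a · e₀ ≡ 0ℚ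
e₀-orthogonal {k} a a₀≡0 = begin
  a zero * 1ℚ + Σℚ k (λ i → a (suc i) * 0ℚ)  ≡⟨ cong₂ _+_ (trans (*-identityʳ _) a₀≡0) (Σℚ-cong k (λ i → *-zeroʳ (a (suc i)))) ⟩
  0ℚ + Σℚ k (λ _ → 0ℚ)                        ≡⟨ trans (+-identityˡ _) (Σℚ-zero k) ⟩
  0ℚ                                          ∎
  where open ≡-Reasoning

-- Gaussian elimination of the first unknown using a pivot row a with a₀ ≠ 0:
-- each row b becomes (tail b) - (b₀/a₀)·(tail a), and a solution x' of the reduced
-- system is extended by the unique x₀ making the pivot equation hold.
module Elimination {k} (a : Fin (suc k) → ℚ) .{{_ : NonZero (a zero)}} where

  tail : (Fin (suc k) → ℚ) → Fin k → ℚ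
  tail b i = b (suc i)

  eliminate : (Fin (suc k) → ℚ) → Fin k → ℚ
  eliminate b i = b (suc i) + (- (b zero * 1/ a zero)) * a (suc i)

  extend : (Fin k → ℚ) → Fin (suc k) → ℚ
  extend x' zero    = - (1/ a zero * (tail a · x'))
  extend x' (suc i) = x' i

  extend-pivot : ∀ x' → a · extend x' ≡ 0ℚ
  extend-pivot x' = begin
    a zero * - (1/ a zero * S) + S  ≡⟨ solve 3 (λ a₀ w S → a₀ :* (:- (w :* S)) :+ S := S :* (con 1ℚ :- a₀ :* w)) refl (a zero) (1/ a zero) S ⟩
    S * (1ℚ - a zero * 1/ a zero)   ≡⟨ cong (λ r → S * (1ℚ - r)) (*-inverseʳ (a zero)) ⟩
    S * (1ℚ - 1ℚ)                   ≡⟨ *-zeroʳ S ⟩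
    0ℚ                              ∎
    where open ≡-Reasoning; S = tail a · x'

  extend-· : ∀ b x' → b · extend x' ≡ eliminate b · x'
  extend-· b x' = begin
    b zero * - (1/ a zero * S) + T  ≡⟨ solve 4 (λ b₀ w S T → b₀ :* (:- (w :* S)) :+ T := T :+ (:- (b₀ :* w)) :* S) refl (b zero) (1/ a zero) S T ⟩
    T + r * S                       ≡⟨ sym (Σℚ-linear k (λ i → tail b i * x' i) (λ i → a (suc i) * x' i) r) ⟩
    Σℚ k (λ i → tail b i * x' i + r * (a (suc i) * x' i))
                                    ≡⟨ Σℚ-cong k (λ i → solve 4 (λ β r α x → β :* x :+ r :* (α :* x) := (β :+ r :* α) :* x) refl (b (suc i)) r (a (suc i)) (x' i)) ⟩
    eliminate b · x'                ∎
    where open ≡-Reasoning; S = tail a · x'; T = tail b · x'; r = - (b zero * 1/ a zero)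

  extend-nonzero : ∀ {x'} → NonZeroVector x' → NonZeroVector (extend x')
  extend-nonzero (i , x'ᵢ≢0) = suc i , x'ᵢ≢0

  extend-solves : ∀ rows {x'} → Solves (List.map eliminate rows) x' → Solves rows (extend x')
  extend-solves rows {x'} reduced-solved = All.map (λ {b} → trans (extend-· b x')) (map⁻ reduced-solved)

nonzero-solution : ∀ k (rows : List (Fin k → ℚ)) → length rows <ℕ k → ∃ λ x → NonZeroVector x × Solves rows x
nonzero-solution (suc k) rows len<k with all? (λ a → a zero ≟ 0ℚ) rows
... | yes first-column-zero = e₀ , (zero , λ ()) , All.map (λ {a} → e₀-orthogonal a) first-column-zero
... | no ¬first-column-zero = pivot-step (¬All⇒Any¬ (λ a → a zero ≟ 0ℚ) rows ¬first-column-zero)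
  where
  pivot-step : Any (λ a → a zero ≢ 0ℚ) rows → ∃ λ x → NonZeroVector x × Solves rows x
  pivot-step pivot∈rows =
    extend x' , extend-nonzero x'-nonzero , ─⁻ pivot∈rows (extend-pivot x') (extend-solves (rows ─ pivot∈rows) x'-solves)
    where
    open Elimination (Any.lookup pivot∈rows) {{≢-nonZero (lookup-result pivot∈rows)}}
    reduced = List.map eliminate (rows ─ pivot∈rows)
    reduced-length : length reduced <ℕ k
    reduced-length = begin-strict
      length reduced                   ≡⟨ List.length-map eliminate (rows ─ pivot∈rows) ⟩
      length (rows ─ pivot∈rows)       <⟨ ℕ.n<1+n _ ⟩
      suc (length (rows ─ pivot∈rows)) ≡⟨ List.length-removeAt′ rows (Any.index pivot∈rows) ⟨
      length rows                      ≤⟨ ℕ.≤-pred len<k ⟩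
      k                                ∎
      where open ℕ.≤-Reasoning
    solution = nonzero-solution k reduced reduced-length
    x' = proj₁ solution
    x'-nonzero = proj₁ (proj₂ solution)
    x'-solves = proj₂ (proj₂ solution)

ForSmallSteps : (ℚ → Set) → Set
ForSmallSteps P = ∃ λ t₀ → 0ℚ < t₀ × (∀ t → t ≤ t₀ → P t)

forSmallSteps-× : ∀ {P Q} → ForSmallSteps P → ForSmallSteps Q → ForSmallSteps (λ t → P t × Q t)
forSmallSteps-× (t₁ , 0<t₁ , P↓) (t₂ , 0<t₂ , Q↓) =
  t₁ ⊓ t₂ , 0<min , λ t t≤min → P↓ t (≤-trans t≤min (p⊓q≤p t₁ t₂)) , Q↓ t (≤-trans t≤min (p⊓q≤q t₁ t₂))
  where
  0<min : 0ℚ < t₁ ⊓ t₂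
  0<min with ⊓-sel t₁ t₂
  ... | inj₁ min≡t₁ = subst (0ℚ <_) (sym min≡t₁) 0<t₁
  ... | inj₂ min≡t₂ = subst (0ℚ <_) (sym min≡t₂) 0<t₂

Room : ℚ → ℚ → ℚ → ℚ → Set
Room t a b c = a < b → t * ∣ c ∣ ≤ b - a

room : ∀ a b c → ForSmallSteps (λ t → Room t a b c)
room a b c with a <? b
... | no a≮b = 1ℚ , positive⁻¹ 1ℚ , λ _ _ a<b → contradiction a<b a≮b
... | yes a<b = t₀ , 0<t₀ , λ t t≤t₀ _ → ≤-trans (*-monoʳ-≤-nonNeg ∣ c ∣ {{∣-∣-nonNeg c}} t≤t₀) t₀∣c∣≤b-a
  where
  D = 1ℚ + ∣ c ∣
  instance
    D-pos : Positive D
    D-pos = pos+nonNeg⇒pos 1ℚ ∣ c ∣ {{∣-∣-nonNeg c}}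
    D≢0 : NonZero D
    D≢0 = pos⇒nonZero D
    b-a-pos : Positive (b - a)
    b-a-pos = positive (subst (_< b - a) (+-inverseʳ a) (+-monoˡ-< (- a) a<b))
    1/D-pos : Positive (1/ D)
    1/D-pos = 1/pos⇒pos D
  t₀ = (b - a) * 1/ D
  0<t₀ : 0ℚ < t₀
  0<t₀ = positive⁻¹ t₀ {{pos*pos⇒pos (b - a) (1/ D)}}
  t₀∣c∣≤b-a : t₀ * ∣ c ∣ ≤ b - a
  t₀∣c∣≤b-a = begin
    t₀ * ∣ c ∣     ≤⟨ *-monoˡ-≤-nonNeg t₀ {{pos⇒nonNeg t₀ {{positive 0<t₀}}}} (subst (_≤ D) (+-identityˡ ∣ c ∣) (+-monoˡ-≤ ∣ c ∣ (<⇒≤ (positive⁻¹ 1ℚ)))) ⟩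
    t₀ * D         ≡⟨ *-assoc (b - a) (1/ D) D ⟩
    (b - a) * (1/ D * D) ≡⟨ cong ((b - a) *_) (*-inverseˡ D) ⟩
    (b - a) * 1ℚ   ≡⟨ *-identityʳ (b - a) ⟩
    b - a          ∎
    where open ≤-Reasoning

room-all : ∀ k (a b c : Fin k → ℚ) → ForSmallSteps (λ t → ∀ i → Room t (a i) (b i) (c i))
room-all zero    a b c = 1ℚ , positive⁻¹ 1ℚ , λ _ _ ()
room-all (suc k) a b c with forSmallSteps-× (room (a zero) (b zero) (c zero)) (room-all k (λ i → a (suc i)) (λ i → b (suc i)) (λ i → c (suc i)))
... | t₀ , 0<t₀ , both = t₀ , 0<t₀ , λ where
  t t≤t₀ zero    → proj₁ (both t t≤t₀)
  t t≤t₀ (suc i) → proj₂ (both t t≤t₀) i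

p≤∣p∣ : ∀ p → p ≤ ∣ p ∣
p≤∣p∣ p with ≤-total 0ℚ p
... | inj₁ 0≤p = ≤-reflexive (sym (0≤p⇒∣p∣≡p 0≤p))
... | inj₂ p≤0 = ≤-trans p≤0 (0≤∣p∣ p)

within : ∀ {a b x} → ∣ x ∣ ≤ b - a → a + x ≤ b × a ≤ b + x
within {a} {b} {x} ∣x∣≤b-a = below x ∣x∣≤b-a , above
  where
  below : ∀ x → ∣ x ∣ ≤ b - a → a + x ≤ b
  below x ∣x∣≤b-a = subst (a + x ≤_) (solve 2 (λ a b → a :+ (b :- a) := b) refl a b) (+-monoʳ-≤ a (≤-trans (p≤∣p∣ x) ∣x∣≤b-a))
  above : a ≤ b + x
  above = subst (_≤ b + x) (solve 2 (λ a x → a :+ (:- x) :+ x := a) refl a x)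
            (+-monoˡ-≤ x (below (- x) (subst (_≤ b - a) (sym (∣-p∣≡∣p∣ x)) ∣x∣≤b-a)))

≤∧≢⇒< : ∀ {p q} → p ≤ q → p ≢ q → p < q
≤∧≢⇒< {p} {q} p≤q p≢q with <-cmp p q
... | tri< p<q _ _ = p<q
... | tri≈ _ p≡q _ = contradiction p≡q p≢q
... | tri> _ _ q<p = contradiction (<-≤-trans q<p p≤q) (<-irrefl refl)

slack-or-fixed : ∀ {a b c} → a ≤ b → (a ≡ b → c ≡ 0ℚ) → a < b ⊎ (a ≡ b × c ≡ 0ℚ)
slack-or-fixed {a} {b} a≤b tight⇒fixed with a ≟ b
... | yes a≡b = inj₂ (a≡b , tight⇒fixed a≡b)
... | no  a≢b = inj₁ (≤∧≢⇒< a≤b a≢b)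

step-bound : ∀ {t a b c u} → a < b ⊎ (a ≡ b × c ≡ 0ℚ) → Room t a b c → ∣ u ∣ ≤ t → ∣ u * c ∣ ≤ b - a
step-bound {t} {a} {b} {c} {u} (inj₁ a<b) has-room ∣u∣≤t = begin
  ∣ u * c ∣      ≡⟨ ∣p*q∣≡∣p∣*∣q∣ u c ⟩
  ∣ u ∣ * ∣ c ∣  ≤⟨ *-monoʳ-≤-nonNeg ∣ c ∣ {{∣-∣-nonNeg c}} ∣u∣≤t ⟩
  t * ∣ c ∣      ≤⟨ has-room a<b ⟩
  b - a          ∎
  where open ≤-Reasoning
step-bound {a = a} {u = u} (inj₂ (refl , refl)) _ _ =
  ≤-reflexive (trans (cong ∣_∣ (*-zeroʳ u)) (sym (+-inverseʳ a)))

ι : ℕ → ℚ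
ι zero    = 0ℚ
ι (suc n) = 1ℚ + ι n

ι-mono : ∀ {a b} → a ≤ℕ b → ι a ≤ ι b
ι-mono {zero}  {zero}  z≤n       = ≤-refl
ι-mono {zero}  {suc b} z≤n       = ≤-trans (ι-mono {zero} {b} z≤n) (subst (_≤ 1ℚ + ι b) (+-identityˡ (ι b)) (+-monoˡ-≤ (ι b) (<⇒≤ (positive⁻¹ 1ℚ))))
ι-mono                 (s≤s a≤b) = +-monoʳ-≤ 1ℚ (ι-mono a≤b)

ι-reflects-< : ∀ {a b} → ι a < ι b → a <ℕ b
ι-reflects-< {a} {b} ιa<ιb with a ℕ.<? b
... | yes a<b = a<b
... | no a≮b  = contradiction (<-≤-trans ιa<ιb (ι-mono (ℕ.≮⇒≥ a≮b))) (<-irrefl refl)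

Σℚ-one : ∀ k → Σℚ k (λ _ → 1ℚ) ≡ ι k
Σℚ-one zero    = refl
Σℚ-one (suc k) = cong (1ℚ +_) (Σℚ-one k)

select : ∀ {A : Set} k {P : Pred (Fin k) 0ℓ} → Decidable P → (Fin k → A) → List A
select zero    P? r = []
select (suc k) P? r with P? zero
... | yes _ = r zero ∷ select k (λ v → P? (suc v)) (λ v → r (suc v))
... | no  _ = select k (λ v → P? (suc v)) (λ v → r (suc v))

select-All : ∀ {A : Set} k {P : Pred (Fin k) 0ℓ} (P? : Decidable P) (r : Fin k → A) {Q : A → Set} →
             All Q (select k P? r) → ∀ v → P v → Q (r v)
select-All (suc k) P? r Qs v Pv with P? zero
select-All (suc k) P? r (Qr₀ ∷ Qs) zero    Pv | yes _ = Qr₀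
select-All (suc k) P? r (Qr₀ ∷ Qs) (suc v) Pv | yes _ = select-All k (λ v → P? (suc v)) (λ v → r (suc v)) Qs v Pv
select-All (suc k) P? r Qs         zero    Pv | no ¬P₀ = contradiction Pv ¬P₀
select-All (suc k) P? r Qs         (suc v) Pv | no _  = select-All k (λ v → P? (suc v)) (λ v → r (suc v)) Qs v Pv

select-length : ∀ {A : Set} k {P : Pred (Fin k) 0ℓ} (P? : Decidable P) (r : Fin k → A) (g : Fin k → ℚ) →
                (∀ v → 0ℚ ≤ g v) → (∀ v → P v → 1ℚ ≤ g v) → ι (length (select k P? r)) ≤ Σℚ k g
select-length zero    P? r g g≥0 P⇒g≥1 = ≤-refl
select-length (suc k) P? r g g≥0 P⇒g≥1 with P? zero
... | yes P₀ = +-mono-≤ (P⇒g≥1 zero P₀) rest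
  where rest = select-length k (λ v → P? (suc v)) (λ v → r (suc v)) (λ v → g (suc v)) (λ v → g≥0 (suc v)) (λ v → P⇒g≥1 (suc v))
... | no _   = subst (_≤ g zero + _) (+-identityˡ _) (+-mono-≤ (g≥0 zero) rest)
  where rest = select-length k (λ v → P? (suc v)) (λ v → r (suc v)) (λ v → g (suc v)) (λ v → g≥0 (suc v)) (λ v → P⇒g≥1 (suc v))

Σℚ-point : ∀ k (a : Fin k) x → Σℚ k (λ v → if ⌊ a Fin.≟ v ⌋ then x else 0ℚ) ≡ x
Σℚ-point (suc k) zero    x = trans (cong (x +_) (Σℚ-zero k)) (+-identityʳ x)
Σℚ-point (suc k) (suc a) x = trans (+-identityˡ _) (trans (Σℚ-cong k shift) (Σℚ-point k a x))
  where
  shift : ∀ v → (if ⌊ suc a Fin.≟ suc v ⌋ then x else 0ℚ) ≡ (if ⌊ a Fin.≟ v ⌋ then x else 0ℚ)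
  shift v with a Fin.≟ v
  ... | yes _ = refl
  ... | no  _ = refl

mask-∨ : ∀ b₁ b₂ {x} → 0ℚ ≤ x → (if b₁ ∨ b₂ then x else 0ℚ) ≤ (if b₁ then x else 0ℚ) + (if b₂ then x else 0ℚ)
mask-∨ true  true  {x} 0≤x = subst (_≤ x + x) (+-identityʳ x) (+-monoʳ-≤ x 0≤x)
mask-∨ true  false {x} 0≤x = ≤-reflexive (sym (+-identityʳ x))
mask-∨ false true  {x} 0≤x = ≤-reflexive (sym (+-identityˡ x))
mask-∨ false false     0≤x = ≤-refl

mask-nonneg : ∀ b {x} → 0ℚ ≤ x → 0ℚ ≤ (if b then x else 0ℚ)
mask-nonneg true  0≤x = 0≤x
mask-nonneg false _   = ≤-refl

module _ {n m : ℕ} (H : Graph n m) where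
  open Graph H

  incidence : Fin n → Fin m → ℚ
  incidence v e = if incident H v e then 1ℚ else 0ℚ

  δsum-incidence : ∀ x v → δsum H x v ≡ incidence v · x
  δsum-incidence x v = Σℚ-cong m (λ e → mask (incident H v e) (x e))
    where
    mask : ∀ b a → (if b then a else 0ℚ) ≡ (if b then 1ℚ else 0ℚ) * a
    mask true  a = sym (*-identityˡ a)
    mask false a = sym (*-zeroˡ a)

  δsum-linear : ∀ y d u v → δsum H (λ e → y e + u * d e) v ≡ δsum H y v + u * δsum H d v
  δsum-linear y d u v = trans (Σℚ-cong m (λ e → mask (incident H v e) (y e) (d e)))
                              (Σℚ-linear m _ _ u)
    where
    mask : ∀ b a x → (if b then a + u * x else 0ℚ) ≡ (if b then a else 0ℚ) + u * (if b then x else 0ℚ)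
    mask true  a x = refl
    mask false a x = solve 1 (λ u → con 0ℚ := con 0ℚ :+ u :* con 0ℚ) refl u

  δsum-nonneg : ∀ {y} → (∀ e → 0ℚ ≤ y e) → ∀ v → 0ℚ ≤ δsum H y v
  δsum-nonneg {y} 0≤y v = Σℚ-nonneg m (λ e → mask-nonneg (incident H v e) (0≤y e))

  -- Handshake inequality: each edge has at most two endpoints, so summing the
  -- degree-constraint left-hand sides over all vertices counts each y_e at most twice.
  handshake : ∀ {y} → (∀ e → 0ℚ ≤ y e) → Σℚ n (δsum H y) ≤ Σℚ m (λ e → y e + y e)
  handshake {y} 0≤y = begin
    Σℚ n (λ v → Σℚ m (λ e → at v e))   ≡⟨ Σℚ-comm n m at ⟩
    Σℚ m (λ e → Σℚ n (λ v → at v e))   ≤⟨ Σℚ-mono m at-most-twice ⟩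
    Σℚ m (λ e → y e + y e)             ∎
    where
    open ≤-Reasoning
    at : Fin n → Fin m → ℚ
    at v e = if incident H v e then y e else 0ℚ
    at-end : Fin n → Fin m → Fin n → ℚ
    at-end a e v = if ⌊ a Fin.≟ v ⌋ then y e else 0ℚ
    at-most-twice : ∀ e → Σℚ n (λ v → at v e) ≤ y e + y e
    at-most-twice e = begin
      Σℚ n (λ v → at v e)                                   ≤⟨ Σℚ-mono n (λ v → mask-∨ ⌊ end₁ e Fin.≟ v ⌋ ⌊ end₂ e Fin.≟ v ⌋ (0≤y e)) ⟩
      Σℚ n (λ v → at-end (end₁ e) e v + at-end (end₂ e) e v)  ≡⟨ Σℚ-+ n _ _ ⟩
      Σℚ n (at-end (end₁ e) e) + Σℚ n (at-end (end₂ e) e)     ≡⟨ cong₂ _+_ (Σℚ-point n (end₁ e) (y e)) (Σℚ-point n (end₂ e) (y e)) ⟩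
      y e + y e                                             ∎

  isolated : ∀ {y} → (∀ e → 0ℚ < y e) → ∀ v → δsum H y v ≡ 0ℚ → ∀ d → δsum H d v ≡ 0ℚ
  isolated {y} 0<y v δy≡0 d = trans (Σℚ-cong m no-edge) (Σℚ-zero m)
    where
    no-edge : ∀ e → (if incident H v e then d e else 0ℚ) ≡ 0ℚ
    no-edge e with incident H v e in e∈δv
    ... | false = refl
    ... | true  = contradiction (sym δy≡0) (<⇒≢ 0<δy)
      where
      0<δy : 0ℚ < δsum H y v
      0<δy = subst (_< δsum H y v) (Σℚ-zero m)
               (Σℚ-mono-< m (λ e' → mask-nonneg (incident H v e') (<⇒≤ (0<y e'))) e
                 (subst (λ b → 0ℚ < (if b then y e else 0ℚ)) (sym e∈δv) (0<y e)))

1≤capacity : ∀ k → 1ℚ ≤ ℤ.+ suc k / 1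
1≤capacity k = subst (1ℚ ≤_) (sym (↥p/↧p≡p (mkℚ (ℤ.+ suc k) 0 (Coprimality.sym (Coprimality.1-coprimeTo (suc k))))))
                 (*≤* (ℤ.+≤+ (s≤s z≤n)))

½<1 : ½ < 1ℚ
½<1 = *<* (ℤ.+<+ (s≤s (s≤s z≤n)))

midpoint : ∀ a c t → a ≡ ½ * (a + t * c) + (1ℚ - ½) * (a + (- t) * c)
midpoint a c t = solve 3 (λ a c t → a := con ½ :* (a :+ t :* c) :+ (con 1ℚ :- con ½) :* (a :+ (:- t) :* c)) refl a c t

opposite-moves : ∀ {a c t} → 0ℚ < t → a + t * c ≡ a + (- t) * c → c ≡ 0ℚ
opposite-moves {a} {c} {t} 0<t same = begin
  c                   ≡⟨ sym (*-identityˡ c) ⟩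
  1ℚ * c              ≡⟨ cong (_* c) (sym (*-inverseˡ 2t)) ⟩
  (1/ 2t * 2t) * c    ≡⟨ *-assoc (1/ 2t) 2t c ⟩
  1/ 2t * (2t * c)    ≡⟨ cong (1/ 2t *_) 2tc≡0 ⟩
  1/ 2t * 0ℚ          ≡⟨ *-zeroʳ (1/ 2t) ⟩
  0ℚ                  ∎
  where
  open ≡-Reasoning
  2t = t + t
  instance
    2t≢0 : NonZero 2t
    2t≢0 = >-nonZero (+-mono-< 0<t 0<t)
  2tc≡0 : 2t * c ≡ 0ℚ
  2tc≡0 = begin
    2t * c                                 ≡⟨ solve 3 (λ a c t → (t :+ t) :* c := (a :+ t :* c) :- (a :+ (:- t) :* c)) refl a c t ⟩
    (a + t * c) - (a + (- t) * c)          ≡⟨ cong (_- (a + (- t) * c)) same ⟩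
    (a + (- t) * c) - (a + (- t) * c)      ≡⟨ +-inverseʳ (a + (- t) * c) ⟩
    0ℚ                                     ∎

module Perturbation {n m} (H : Graph n m) (f : Fin n → ℕ) (C : Subset n) {y : Fin m → ℚ} {z : Fin n → ℚ}
  (feasible : Feasible H f C y z) (0<y : ∀ e → 0ℚ < y e) (y<½ : ∀ e → y e < ½) (0<m : 0 <ℕ m) where

  F : Fin n → ℚ
  F v = ℤ.+ f v / 1

  δ : (Fin m → ℚ) → Fin n → ℚ
  δ = δsum H

  -- The degree constraint at v holds with equality and its right-hand side cannot move:
  -- either v ∈ C, or z_v = 0 sits at its own lower bound.
  Tight : Fin n → Set
  Tight v = (v ∈ C ⊎ z v ≡ 0ℚ) × δ y v ≡ F v

  Critical : Fin n → Set
  Critical v = Tight v × 1 ≤ℕ f v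

  critical? : ∀ v → Dec (Critical v)
  critical? v = (((v ∈? C) ⊎-dec (z v ≟ 0ℚ)) ×-dec (δ y v ≟ F v)) ×-dec (1 ℕ.≤? f v)

  rows : List (Fin m → ℚ)
  rows = select n critical? (incidence H)

  -- There are fewer critical vertices than edges: each critical v has δ y v = f_v ≥ 1,
  -- while by the handshake inequality Σ_v δ y v ≤ Σ_e 2 y_e < m.
  few-rows : length rows <ℕ m
  few-rows = ι-reflects-< (begin-strict
    ι (length rows)          ≤⟨ select-length n critical? (incidence H) (δ y) (δsum-nonneg H 0≤y) critical⇒1≤δy ⟩
    Σℚ n (δ y)               ≤⟨ handshake H 0≤y ⟩
    Σℚ m (λ e → y e + y e)   <⟨ Σℚ-mono-< m (λ e → <⇒≤ (2y<1 e)) (fromℕ< 0<m) (2y<1 (fromℕ< 0<m)) ⟩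
    Σℚ m (λ _ → 1ℚ)          ≡⟨ Σℚ-one m ⟩
    ι m                      ∎)
    where
    open ≤-Reasoning
    0≤y : ∀ e → 0ℚ ≤ y e
    0≤y e = <⇒≤ (0<y e)
    2y<1 : ∀ e → y e + y e < 1ℚ
    2y<1 e = +-mono-< (y<½ e) (y<½ e)
    critical⇒1≤δy : ∀ v → Critical v → 1ℚ ≤ δ y v
    critical⇒1≤δy v ((_ , δy≡F) , 1≤f) with f v | 1≤f | δy≡F
    ... | suc k | s≤s _ | δy≡F' = subst (1ℚ ≤_) (sym δy≡F') (1≤capacity k)

  direction : ∃ λ d → NonZeroVector d × Solves rows d
  direction = nonzero-solution m rows few-rows

  d : Fin m → ℚ
  d = proj₁ direction

  s : Fin n → ℚ
  s = δ d

  -- Tight constraints do not move: critical ones by the choice of d, and those with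
  -- f_v = 0 because then v has no incident edge (all y_e > 0).
  tight⇒s≡0 : ∀ v → Tight v → s v ≡ 0ℚ
  tight⇒s≡0 v tight = by-capacity (f v) refl
    where
    by-capacity : ∀ k → f v ≡ k → s v ≡ 0ℚ
    by-capacity zero    fv≡0   = isolated H 0<y v (trans (proj₂ tight) (cong (λ k → ℤ.+ k / 1) fv≡0)) d
    by-capacity (suc _) fv≡1+k = trans (δsum-incidence H d v)
                                   (select-All n critical? (incidence H) (proj₂ (proj₂ direction)) v
                                     (tight , subst (1 ≤ℕ_) (sym fv≡1+k) (s≤s z≤n)))

  -- The z-part of the direction follows s where z_v > 0 (keeping those constraints'
  -- slack unchanged) and is 0 where z_v = 0.
  w-at : ∀ v → Dec (0ℚ < z v) → ℚ
  w-at v (yes _) = s v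
  w-at v (no  _) = 0ℚ

  w : Fin n → ℚ
  w v = w-at v (0ℚ <? z v)

  y[_] : ℚ → Fin m → ℚ
  y[ u ] e = y e + u * d e

  z[_] : ℚ → Fin n → ℚ
  z[ u ] v = z v + u * w v

  Rooms : ℚ → Set
  Rooms t = (∀ e → Room t 0ℚ (y e) (d e)) × (∀ e → Room t (y e) 1ℚ (d e)) × (∀ v → Room t 0ℚ (z v) (s v))
          × (∀ v → Room t (δ y v) (F v + z v) (s v)) × (∀ v → Room t (δ y v) (F v) (s v))

  rooms : ForSmallSteps Rooms
  rooms = forSmallSteps-× (room-all m (λ _ → 0ℚ) y d)
         (forSmallSteps-× (room-all m y (λ _ → 1ℚ) d)
         (forSmallSteps-× (room-all n (λ _ → 0ℚ) z s)
         (forSmallSteps-× (room-all n (δ y) (λ v → F v + z v) s) (room-all n (δ y) F s))))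

  perturbed-feasible : ∀ {t u} → Rooms t → ∣ u ∣ ≤ t → Feasible H f C y[ u ] z[ u ]
  perturbed-feasible {t} {u} (room-y₀ , room-y₁ , room-z , room-out , room-in) ∣u∣≤t =
    outside , inside , z-nonneg , y-bounds
    where
    δ-moves : ∀ v → δ y[ u ] v ≡ δ y v + u * s v
    δ-moves = δsum-linear H y d u

    unmoved : ∀ x → x + u * 0ℚ ≡ x
    unmoved x = trans (cong (x +_) (*-zeroʳ u)) (+-identityʳ x)

    outside : ∀ v → v ∉ C → δ y[ u ] v ≤ F v + z[ u ] v
    outside v v∉C = subst (_≤ F v + z[ u ] v) (sym (δ-moves v)) (by-sign (0ℚ <? z v))
      where
      feasible-v : δ y v ≤ F v + z v
      feasible-v = proj₁ feasible v v∉C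
      by-sign : (0<z? : Dec (0ℚ < z v)) → δ y v + u * s v ≤ F v + (z v + u * w-at v 0<z?)
      by-sign (yes _) = subst (δ y v + u * s v ≤_) (+-assoc (F v) (z v) (u * s v)) (+-monoˡ-≤ (u * s v) feasible-v)
      by-sign (no 0≮z) = subst (δ y v + u * s v ≤_) (cong (F v +_) (sym (unmoved (z v))))
                           (proj₁ (within {δ y v} {F v + z v} (step-bound (slack-or-fixed feasible-v tight⇒fixed) (room-out v) ∣u∣≤t)))
        where
        z≡0 : z v ≡ 0ℚ
        z≡0 = ≤-antisym (≮⇒≥ 0≮z) (proj₁ (proj₂ (proj₂ feasible)) v)
        tight⇒fixed : δ y v ≡ F v + z v → s v ≡ 0ℚ
        tight⇒fixed δy≡F+z = tight⇒s≡0 v (inj₂ z≡0 , trans δy≡F+z (trans (cong (F v +_) z≡0) (+-identityʳ (F v))))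

    inside : ∀ v → v ∈ C → δ y[ u ] v ≤ F v
    inside v v∈C = subst (_≤ F v) (sym (δ-moves v))
      (proj₁ (within {δ y v} {F v} (step-bound (slack-or-fixed (proj₁ (proj₂ feasible) v v∈C) (λ δy≡F → tight⇒s≡0 v (inj₁ v∈C , δy≡F)))
                                              (room-in v) ∣u∣≤t)))
    z-nonneg : ∀ v → 0ℚ ≤ z[ u ] v
    z-nonneg v = by-sign (0ℚ <? z v)
      where
      by-sign : (0<z? : Dec (0ℚ < z v)) → 0ℚ ≤ z v + u * w-at v 0<z?
      by-sign (yes 0<z) = proj₂ (within {0ℚ} {z v} (step-bound (inj₁ 0<z) (room-z v) ∣u∣≤t))
      by-sign (no  _)   = subst (0ℚ ≤_) (sym (unmoved (z v))) (proj₁ (proj₂ (proj₂ feasible)) v)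

    y-bounds : ∀ e → 0ℚ ≤ y[ u ] e × y[ u ] e ≤ 1ℚ
    y-bounds e = proj₂ (within {0ℚ} {y e} (step-bound (inj₁ (0<y e)) (room-y₀ e) ∣u∣≤t))
               , proj₁ (within {y e} (step-bound (inj₁ (<-trans (y<½ e) ½<1)) (room-y₁ e) ∣u∣≤t))

  not-extreme : ¬ ExtremePoint H f C y z
  not-extreme (_ , extreme) = contradiction (d≡0 i) dᵢ≢0
    where
    t = proj₁ rooms
    0<t = proj₁ (proj₂ rooms)
    room-t : Rooms t
    room-t = proj₂ (proj₂ rooms) t ≤-refl
    ∣t∣≤t : ∣ t ∣ ≤ t
    ∣t∣≤t = ≤-reflexive (0≤p⇒∣p∣≡p (<⇒≤ 0<t))
    ∣-t∣≤t : ∣ - t ∣ ≤ t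
    ∣-t∣≤t = subst (_≤ t) (sym (∣-p∣≡∣p∣ t)) ∣t∣≤t
    same-y : ∀ e → y[ t ] e ≡ y[ - t ] e
    same-y = proj₁ (extreme y[ t ] z[ t ] y[ - t ] z[ - t ] ½
                      (perturbed-feasible room-t ∣t∣≤t) (perturbed-feasible room-t ∣-t∣≤t)
                      (positive⁻¹ ½) ½<1 (λ e → midpoint (y e) (d e) t) (λ v → midpoint (z v) (w v) t))
    d≡0 : ∀ e → d e ≡ 0ℚ
    d≡0 e = opposite-moves {y e} 0<t (same-y e)
    i = proj₁ (proj₁ (proj₂ direction))
    dᵢ≢0 = proj₂ (proj₁ (proj₂ direction))
-- Lemma 6.  If every y_e were in (0, ½), the point would not be extreme.
lemma6 : {n m : ℕ} (H : Graph n m) → 0 <ℕ m → (f : Fin n → ℕ) (C : Subset n) (ε : ℚ) → 0ℚ < ε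
         → (y : Fin m → ℚ) (z : Fin n → ℚ) → ExtremePoint H f C y z
         → ∃ λ (e : Fin m) → (y e ≡ 0ℚ) ⊎ (½ ≤ y e)
lemma6 H 0<m f C ε 0<ε y z extreme with Fin.any? (λ e → (y e ≟ 0ℚ) ⊎-dec (½ ≤? y e))
... | yes found = found
... | no  none  = contradiction extreme (Perturbation.not-extreme H f C feasible 0<y y<½ 0<m)
  where
  feasible = proj₁ extreme
  0<y : ∀ e → 0ℚ < y e
  0<y e = ≤∧≢⇒< (proj₁ (proj₂ (proj₂ (proj₂ feasible)) e)) (λ 0≡y → none (e , inj₁ (sym 0≡y)))
  y<½ : ∀ e → y e < ½
  y<½ e = ≰⇒> (λ ½≤y → none (e , inj₂ ½≤y))
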